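{- Consider any run of the roundabout exploration process and let $t\in[N]$. Let $s=|A(t)|$, and let $1\le i_1<i_2<\dots<i_s\le N$ be the indices of the agents in $A(t)$, so that $A(t)=\{a_{i_1},\dots,a_{i_s}\}$ and $i_\ell$ is the initial state of $a_{i_\ell}$. Then: (i) $[i_\ell,i_{\ell+1})\subseteq D_{i_\ell}(t)$ for every $\ell\in[s-1]$; (ii) $[i_s,i_1)\subseteq D_{i_s}(t)$.
   Context: Let $n\ge2$ and $k\ge1$ be integers, and let $T$ be a tree on a vertex set $V$ with $|V|=n$, rooted at $r$. DFS tour. Fix a depth-first-search tour of $T$ that starts and ends at $r$ and traverses each edge of $T$ exactly twice. Write it as $(v_1,\dots,v_N,v_{N+1})$ with $v_1=v_{N+1}=r$ and $N=2(n-1)$, and put $e_i=\{v_i,v_{i+1}\}$ for $i\in[N]$. Circular intervals. For $i,j\in[N]$, let $[i,j]=\{i,\dots,j\}$ if $i\le j$, and $[i,j]=\{i,\dots,N,1,\dots,j\}$ if $i>j$. Let $[i,j)=[i,j]\setminus\{j\}$. Snapshots. Let $G_1,\dots,G_N$ be graphs on $V$, each containing all but at most $k$ edges of $T$. Roundabout exploration process. There are agents $a_1,\dots,a_N$ with initial states $s_i(0)=i$. Set $D_i(0)=\{i\}$ and $A(0)=\{a_1,\dots,a_N\}$. For $t=1,\dots,N$ do: (1) Movement: if $s_i(t-1)=q$, then $s_i(t)=(q\bmod N)+1$ if $e_q\in E(G_t)$, and $s_i(t)=q$ otherwise. (2) Elimination: let $D_i(t)=[i,s_i(t)]$. Starting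 from $A(t-1)$, repeatedly remove an arbitrary agent $a_i$ of the current set with $D_i(t)\subseteq\bigcup_{a_j\text{ in current set},\,j\neq i}D_j(t)$, until no such agent remains. The result is $A(t)$. A run is any execution of this process, i.e. any choice of removed agents. -}

module Defs where

open import Data.Nat using (ℕ; zero; suc; _*_; _∸_; _≤_; _<_; _%_; _<ᵇ_; _≡ᵇ_; _≤ᵇ_)
open import Data.Bool using (Bool; true; false; if_then_else_; _∧_; _∨_; not)
open import Data.Fin using (Fin; toℕ)
import Data.Fin as F
open import Data.List using (List; []; _∷_; length; map; filterᵇ; concatMap; upTo; allFin)
open import Data.Product using (_×_; _,_; proj₁; proj₂; ∃)
open import Data.Sum using (_⊎_)
open import Data.Unit using (⊤)
open import Relation.Binary.PropositionalEquality using (_≡_; _≢_)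
open import Relation.Nullary using (¬_)
open import Relation.Nullary.Decidable using (⌊_⌋)

record Graph (n : ℕ) : Set where
  field
    adj        : Fin n → Fin n → Bool
    adj-sym    : ∀ u v → adj u v ≡ adj v u
    adj-irrefl : ∀ u → adj u u ≡ false
open Graph public

data Walk {n : ℕ} (G : Graph n) : Fin n → Fin n → Set where
  here : ∀ {u} → Walk G u u
  step : ∀ {u w v} → adj G u w ≡ true → Walk G w v → Walk G u v

Connected : {n : ℕ} → Graph n → Set
Connected G = ∀ u v → Walk G u v

pairs : (n : ℕ) → List (Fin n × Fin n)
pairs n = filterᵇ (λ p → toℕ (proj₁ p) <ᵇ toℕ (proj₂ p))
                  (concatMap (λ u → map (u ,_) (allFin n)) (allFin n))

edgeCount : {n : ℕ} → Graph n → ℕ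
edgeCount {n} G = length (filterᵇ (λ p → adj G (proj₁ p) (proj₂ p)) (pairs n))

IsTree : {n : ℕ} → Graph n → Set
IsTree {n} T = Connected T × edgeCount T ≡ n ∸ 1

missingEdges : {n : ℕ} → Graph n → Graph n → ℕ
missingEdges {n} T G =
  length (filterᵇ (λ p → adj T (proj₁ p) (proj₂ p) ∧ not (adj G (proj₁ p) (proj₂ p))) (pairs n))

-- DFS tour  (v_1, …, v_N, v_{N+1}),  N = 2(n-1); the tour is a map ℕ → V,
-- only its values at 1 … N+1 matter.

tourLength : ℕ → ℕ
tourLength n = 2 * (n ∸ 1)

feq : {n : ℕ} → Fin n → Fin n → Bool
feq u v = ⌊ u F.≟ v ⌋

sameEdge : {n : ℕ} → Fin n → Fin n → Fin n → Fin n → Bool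
sameEdge a b u v = (feq a u ∧ feq b v) ∨ (feq a v ∧ feq b u)

traversals : {n : ℕ} → (ℕ → Fin n) → Fin n → Fin n → ℕ
traversals {n} tour u v =
  length (filterᵇ (λ i → sameEdge (tour i) (tour (suc i)) u v) (map suc (upTo (tourLength n))))

IsDFSTour : {n : ℕ} → Graph n → Fin n → (ℕ → Fin n) → Set
IsDFSTour {n} T r tour =
  tour 1 ≡ r × tour (suc (tourLength n)) ≡ r
  × (∀ i → 1 ≤ i → i ≤ tourLength n → adj T (tour i) (tour (suc i)) ≡ true)
  × (∀ u v → toℕ u < toℕ v → adj T u v ≡ true → traversals tour u v ≡ 2)

CInt : ℕ → ℕ → ℕ → ℕ → Set
CInt N i j x = (i ≤ j × i ≤ x × x ≤ j) ⊎ (j < i × ((i ≤ x × x ≤ N) ⊎ (1 ≤ x × x ≤ j)))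

CIntHO : ℕ → ℕ → ℕ → ℕ → Set
CIntHO N i j x = CInt N i j x × x ≢ j

-- q mod N (with the harmless convention q mod 0 = q)
modN : ℕ → ℕ → ℕ
modN q zero    = q
modN q (suc d) = q % suc d

module Process {n : ℕ} (tour : ℕ → Fin n) (G : ℕ → Graph n) where

  N : ℕ
  N = tourLength n

  edgePresent : ℕ → ℕ → Bool
  edgePresent t q = adj (G t) (tour q) (tour (suc q))

  move : ℕ → ℕ → ℕ
  move t q = if edgePresent t q then suc (modN q N) else q

  state : ℕ → ℕ → ℕ
  state i zero    = i
  state i (suc t) = move (suc t) (state i t)

  D : ℕ → ℕ → ℕ → Set
  D i t x = CInt N i (state i t) x

  -- sets of agents, identified with their indices (membership as Bool)
  AgentSet : Set
  AgentSet = ℕ → Bool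

  initial : AgentSet
  initial x = (1 ≤ᵇ x) ∧ (x ≤ᵇ N)

  remove : AgentSet → ℕ → AgentSet
  remove S i x = S x ∧ not (x ≡ᵇ i)

  removeAll : AgentSet → List ℕ → AgentSet
  removeAll S []       = S
  removeAll S (i ∷ is) = removeAll (remove S i) is

  Redundant : ℕ → AgentSet → ℕ → Set
  Redundant t S i = ∀ x → D i t x → ∃ λ j → S j ≡ true × j ≢ i × D j t x

  ValidElim : ℕ → AgentSet → List ℕ → Set
  ValidElim t S []       = ⊤
  ValidElim t S (i ∷ is) = S i ≡ true × Redundant t S i × ValidElim t (remove S i) is

  -- a run is described by the list rem t of agents removed (in order) at time t
  -- A(t)
  alive : (ℕ → List ℕ) → ℕ → AgentSet
  alive rem zero    = initial
  alive rem (suc t) = removeAll (alive rem t) (rem (suc t))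

  IsRun : (ℕ → List ℕ) → Set
  IsRun rem = ∀ t → 1 ≤ t → t ≤ N →
    ValidElim t (alive rem (t ∸ 1)) (rem t)
    × (∀ i → alive rem t i ≡ true → ¬ Redundant t (alive rem t) i)

{-# OPTIONS --safe #-}
-- Measure the cycle [N] from each agent's start: dist i x is the clockwise
-- distance from i to x and moves i t counts the steps agent i has taken by
-- time t, so that D_i(t) = {x | dist i x ≤ moves i t} until the agent
-- completes a full lap. The invariant carried through the process is that
-- every living agent has reached each point before its successor among the
-- living agents. Moving only extends what is reached. When a redundant agent m
-- is removed, its predecessor i inherits m's gap: a point x of that gap lies
-- in D_m, hence in some other D_l; if l ≠ i then D_l wraps around past i, and
-- since agents in the same state move together, l never gets a full lap ahead
-- of i, so i has reached x too. An agent completing a lap had explored all of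
-- [N] one step earlier, making every other agent redundant; it is then alone,
-- and the collapse of its D_i(t) to {i} is harmless.
module Submission where

open import Defs
open import Data.Nat
  using (ℕ; zero; suc; _+_; _∸_; _≤_; _<_; z≤n; s≤s; NonZero; _%_; _≡ᵇ_; >-nonZero; >-nonZero⁻¹)
open import Data.Nat.Properties
open import Algebra.Properties.CommutativeSemigroup +-commutativeSemigroup using (x∙yz≈y∙xz)
open import Data.Nat.DivMod
  using (%-distribˡ-+; m%n%n≡m%n; %-remove-+ˡ; m<n⇒m%n≡m; m%n<n; m%n≤n; m%n≤m)
open import Data.Nat.Divisibility using (∣-refl)
open import Data.Bool using (Bool; true; false; if_then_else_; T)
open import Data.Bool.Properties using (T-≡; T-∧)
open import Data.Unit using (tt)
open import Function.Bundles using (Equivalence)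
open import Data.Product using (_×_; _,_; proj₁; proj₂)
open import Data.Sum using (_⊎_; inj₁; inj₂)
open import Data.List using (List; []; _∷_)
open import Data.Fin using (Fin)
open import Relation.Binary.PropositionalEquality
open import Relation.Binary.Definitions using (tri<; tri≈; tri>)
open import Relation.Nullary using (yes; no; contradiction)

module Circle (N : ℕ) .{{_ : NonZero N}} where

  infix 4 _≋_ _∈[N]

  _≋_ : ℕ → ℕ → Set
  a ≋ b = a % N ≡ b % N

  ≋-+ : ∀ {a b c d} → a ≋ b → c ≋ d → a + c ≋ b + d
  ≋-+ {a} {b} {c} {d} a≋b c≋d = begin
    (a + c) % N           ≡⟨ %-distribˡ-+ a c N ⟩
    (a % N + c % N) % N   ≡⟨ cong₂ (λ u v → (u + v) % N) a≋b c≋d ⟩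
    (b % N + d % N) % N   ≡⟨ %-distribˡ-+ b d N ⟨
    (b + d) % N           ∎
    where open ≡-Reasoning

  %-≋ : ∀ a → a % N ≋ a
  %-≋ a = m%n%n≡m%n a N

  N+-≋ : ∀ a → N + a ≋ a
  N+-≋ a = %-remove-+ˡ a ∣-refl

  ≋-cancelˡ : ∀ c {a b} → c + a ≋ c + b → a ≋ b
  ≋-cancelˡ c {a} {b} e = trans (undo a) (trans (≋-+ {c′} refl e) (sym (undo b)))
    where
    c′ = N ∸ c % N
    -- c′ + c is a multiple of N
    undo : ∀ a → a ≋ c′ + (c + a)
    undo a = begin
      a % N                    ≡⟨ N+-≋ a ⟨
      (N + a) % N              ≡⟨ cong (λ u → (u + a) % N) (m∸n+n≡m (m%n≤n c N)) ⟨
      ((c′ + c % N) + a) % N   ≡⟨ ≋-+ (≋-+ {c′} refl (%-≋ c)) refl ⟩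
      ((c′ + c) + a) % N       ≡⟨ cong (_% N) (+-assoc c′ c a) ⟩
      (c′ + (c + a)) % N       ∎
      where open ≡-Reasoning

  ≋-<⇒≡ : ∀ {a b} → a < N → b < N → a ≋ b → a ≡ b
  ≋-<⇒≡ a<N b<N e = trans (sym (m<n⇒m%n≡m a<N)) (trans e (m<n⇒m%n≡m b<N))

  _∈[N] : ℕ → Set
  x ∈[N] = 1 ≤ x × x ≤ N

  ∈[N]-≋⇒≡ : ∀ {x y} → x ∈[N] → y ∈[N] → x ≋ y → x ≡ y
  ∈[N]-≋⇒≡ (s≤s _ , x≤N) (s≤s _ , y≤N) e = cong suc (≋-<⇒≡ x≤N y≤N (≋-cancelˡ 1 e))

  dist : ℕ → ℕ → ℕ
  dist a b = (N ∸ a + b) % N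

  dist<N : ∀ a b → dist a b < N
  dist<N a b = m%n<n (N ∸ a + b) N

  dist-spec : ∀ {a} b → a ≤ N → a + dist a b ≋ b
  dist-spec {a} b a≤N = begin
    (a + dist a b) % N       ≡⟨ ≋-+ {a} refl (%-≋ (N ∸ a + b)) ⟩
    (a + (N ∸ a + b)) % N    ≡⟨ cong (_% N) (+-assoc a (N ∸ a) b) ⟨
    (a + (N ∸ a) + b) % N    ≡⟨ cong (λ u → (u + b) % N) (m+[n∸m]≡n a≤N) ⟩
    (N + b) % N              ≡⟨ N+-≋ b ⟩
    b % N                    ∎
    where open ≡-Reasoning

  dist-unique : ∀ {a b d} → a ≤ N → d < N → a + d ≋ b → d ≡ dist a b
  dist-unique {a} {b} a≤N d<N e =
    ≋-<⇒≡ d<N (dist<N a b) (≋-cancelˡ a (trans e (sym (dist-spec b a≤N))))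

  dist-self : ∀ {a} → a ≤ N → dist a a ≡ 0
  dist-self {a} a≤N = sym (dist-unique a≤N (>-nonZero⁻¹ N) (cong (_% N) (+-identityʳ a)))

  dist-injective : ∀ {i x y} → i ≤ N → x ∈[N] → y ∈[N] → dist i x ≡ dist i y → x ≡ y
  dist-injective {i} {x} {y} i≤N x∈ y∈ e = ∈[N]-≋⇒≡ x∈ y∈
    (trans (sym (dist-spec x i≤N)) (trans (cong (λ d → (i + d) % N) e) (dist-spec y i≤N)))

  dist-≤ : ∀ {a b} → a ∈[N] → b ∈[N] → a ≤ b → a + dist a b ≡ b
  dist-≤ {a} {b} (1≤a , a≤N) (_ , b≤N) a≤b =
    trans (cong (a +_) (sym (dist-unique a≤N b∸a<N (cong (_% N) a+[b∸a]≡b)))) a+[b∸a]≡b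
    where
    a+[b∸a]≡b = m+[n∸m]≡n a≤b
    b∸a<N = m<n+o⇒m∸n<o b a (≤-<-trans b≤N (m<n+m N 1≤a))

  dist-> : ∀ {a b} → a ∈[N] → b ∈[N] → b < a → a + dist a b ≡ N + b
  dist-> {a} {b} (_ , a≤N) _ b<a =
    trans (cong (a +_) (sym (dist-unique a≤N d<N (trans (cong (_% N) a+d≡N+b) (N+-≋ b))))) a+d≡N+b
    where
    a+d≡N+b = m+[n∸m]≡n (≤-trans a≤N (m≤m+n N b))
    d<N = m<n+o⇒m∸n<o (N + b) a (subst (N + b <_) (+-comm N a) (+-monoʳ-< N b<a))

  dist-triangle : ∀ {a b} c → a ≤ N → b ≤ N → dist a b + dist b c ≋ dist a c
  dist-triangle {a} {b} c a≤N b≤N = ≋-cancelˡ a (begin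
    (a + (dist a b + dist b c)) % N   ≡⟨ cong (_% N) (+-assoc a (dist a b) (dist b c)) ⟨
    (a + dist a b + dist b c) % N     ≡⟨ ≋-+ (dist-spec b a≤N) refl ⟩
    (b + dist b c) % N                ≡⟨ dist-spec c b≤N ⟩
    c % N                             ≡⟨ dist-spec c a≤N ⟨
    (a + dist a c) % N                ∎)
    where open ≡-Reasoning

  ≋-<⇒≡⊎≡N+ : ∀ {x y} → y < N → x < N + N → x ≋ y → x ≡ y ⊎ x ≡ N + y
  ≋-<⇒≡⊎≡N+ {x} {y} y<N x<N+N x≋y with x <? N
  ... | yes x<N = inj₁ (≋-<⇒≡ x<N y<N x≋y)
  ... | no x≮N  = inj₂ (trans (sym N+x∸N≡x) (cong (N +_) x∸N≡y))
    where
    N+x∸N≡x = m+[n∸m]≡n (≮⇒≥ x≮N)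
    x∸N≡y = ≋-<⇒≡ (m<n+o⇒m∸n<o x N x<N+N) y<N
              (trans (sym (N+-≋ (x ∸ N))) (trans (cong (_% N) N+x∸N≡x) x≋y))

  dist-+ : ∀ {a b c} → a ≤ N → b ≤ N → dist a b ≤ dist a c → dist a b + dist b c ≡ dist a c
  dist-+ {a} {b} {c} a≤N b≤N ab≤ac
    with ≋-<⇒≡⊎≡N+ (dist<N a c) (+-mono-< (dist<N a b) (dist<N b c)) (dist-triangle c a≤N b≤N)
  ... | inj₁ e = e
  ... | inj₂ e = contradiction (begin-strict
    N + dist a c            ≡⟨ e ⟨
    dist a b + dist b c     <⟨ +-monoʳ-< (dist a b) (dist<N b c) ⟩
    dist a b + N            ≤⟨ +-monoˡ-≤ N ab≤ac ⟩
    dist a c + N            ≡⟨ +-comm (dist a c) N ⟩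
    N + dist a c            ∎) (<-irrefl refl)
    where open ≤-Reasoning

  dist-+-wrap : ∀ {a b c} → a ≤ N → b ≤ N → dist a c < dist a b → dist a b + dist b c ≡ N + dist a c
  dist-+-wrap {a} {b} {c} a≤N b≤N ac<ab
    with ≋-<⇒≡⊎≡N+ (dist<N a c) (+-mono-< (dist<N a b) (dist<N b c)) (dist-triangle c a≤N b≤N)
  ... | inj₁ e = contradiction (<-≤-trans ac<ab (≤-trans (m≤m+n _ _) (≤-reflexive e))) (<-irrefl refl)
  ... | inj₂ e = e

  dist-cycle : ∀ {a b} → a ∈[N] → b ∈[N] → a ≢ b → dist a b + dist b a ≡ N
  dist-cycle {a} {b} a∈@(_ , a≤N) b∈@(_ , b≤N) a≢b = begin
    dist a b + dist b a   ≡⟨ dist-+-wrap a≤N b≤N aa<ab ⟩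
    N + dist a a          ≡⟨ cong (N +_) (dist-self a≤N) ⟩
    N + 0                 ≡⟨ +-identityʳ N ⟩
    N                     ∎
    where
    open ≡-Reasoning
    ab≢0 : dist a b ≢ 0
    ab≢0 ab≡0 = a≢b (dist-injective a≤N a∈ b∈ (trans (dist-self a≤N) (sym ab≡0)))
    aa<ab : dist a a < dist a b
    aa<ab = subst (_< dist a b) (sym (dist-self a≤N)) (n≢0⇒n>0 ab≢0)

  CInt⇒dist≤ : ∀ {i j x} → i ∈[N] → j ∈[N] → CInt N i j x → x ∈[N] × dist i x ≤ dist i j
  CInt⇒dist≤ {i} {j} {x} i∈@(1≤i , _) j∈@(_ , j≤N) (inj₁ (i≤j , i≤x , x≤j)) =
    x∈ , +-cancelˡ-≤ i _ _ (begin
      i + dist i x   ≡⟨ dist-≤ i∈ x∈ i≤x ⟩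
      x              ≤⟨ x≤j ⟩
      j              ≡⟨ dist-≤ i∈ j∈ i≤j ⟨
      i + dist i j   ∎)
    where
    open ≤-Reasoning
    x∈ = ≤-trans 1≤i i≤x , ≤-trans x≤j j≤N
  CInt⇒dist≤ {i} {j} {x} i∈@(1≤i , _) j∈ (inj₂ (j<i , inj₁ (i≤x , x≤N))) =
    x∈ , +-cancelˡ-≤ i _ _ (begin
      i + dist i x   ≡⟨ dist-≤ i∈ x∈ i≤x ⟩
      x              ≤⟨ x≤N ⟩
      N              ≤⟨ m≤m+n N j ⟩
      N + j          ≡⟨ dist-> i∈ j∈ j<i ⟨
      i + dist i j   ∎)
    where
    open ≤-Reasoning
    x∈ = ≤-trans 1≤i i≤x , x≤N
  CInt⇒dist≤ {i} {j} {x} i∈ j∈@(_ , j≤N) (inj₂ (j<i , inj₂ (1≤x , x≤j))) =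
    x∈ , +-cancelˡ-≤ i _ _ (begin
      i + dist i x   ≡⟨ dist-> i∈ x∈ (≤-<-trans x≤j j<i) ⟩
      N + x          ≤⟨ +-monoʳ-≤ N x≤j ⟩
      N + j          ≡⟨ dist-> i∈ j∈ j<i ⟨
      i + dist i j   ∎)
    where
    open ≤-Reasoning
    x∈ = 1≤x , ≤-trans x≤j j≤N

  dist≤⇒CInt : ∀ {i j x} → i ∈[N] → j ∈[N] → x ∈[N] → dist i x ≤ dist i j → CInt N i j x
  dist≤⇒CInt {i} {j} {x} i∈ j∈@(_ , j≤N) x∈@(1≤x , x≤N) ix≤ij with i ≤? x | i ≤? j
  ... | yes i≤x | yes i≤j = inj₁ (i≤j , i≤x , (begin
    x              ≡⟨ dist-≤ i∈ x∈ i≤x ⟨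
    i + dist i x   ≤⟨ +-monoʳ-≤ i ix≤ij ⟩
    i + dist i j   ≡⟨ dist-≤ i∈ j∈ i≤j ⟩
    j              ∎))
    where open ≤-Reasoning
  ... | yes i≤x | no i≰j = inj₂ (≰⇒> i≰j , inj₁ (i≤x , x≤N))
  ... | no i≰x  | yes i≤j = contradiction (begin-strict
    N              <⟨ m<m+n N 1≤x ⟩
    N + x          ≡⟨ dist-> i∈ x∈ (≰⇒> i≰x) ⟨
    i + dist i x   ≤⟨ +-monoʳ-≤ i ix≤ij ⟩
    i + dist i j   ≡⟨ dist-≤ i∈ j∈ i≤j ⟩
    j              ≤⟨ j≤N ⟩
    N              ∎) (<-irrefl refl)
    where open ≤-Reasoning
  ... | no i≰x  | no i≰j = inj₂ (≰⇒> i≰j , inj₂ (1≤x , +-cancelˡ-≤ N x j (begin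
    N + x          ≡⟨ dist-> i∈ x∈ (≰⇒> i≰x) ⟨
    i + dist i x   ≤⟨ +-monoʳ-≤ i ix≤ij ⟩
    i + dist i j   ≡⟨ dist-> i∈ j∈ (≰⇒> i≰j) ⟩
    N + j          ∎)))
    where open ≤-Reasoning

  Successor : (ℕ → Bool) → ℕ → ℕ → Set
  Successor S i j = ∀ {l} → S l ≡ true → l ≢ i → dist i j ≤ dist i l

  consecutive⇒successor : ∀ {S i j} → (∀ {l} → S l ≡ true → l ∈[N]) → i ∈[N] → j ∈[N] → i < j
    → (∀ m → i < m → m < j → S m ≡ false) → Successor S i j
  consecutive⇒successor {S} {i} {j} S⊆[N] i∈ j∈@(_ , j≤N) i<j gap {l} Sl l≢i
    with <-cmp i l
  ... | tri≈ _ i≡l _ = contradiction (sym i≡l) l≢i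
  ... | tri< i<l _ _ = +-cancelˡ-≤ i _ _ (begin
    i + dist i j   ≡⟨ dist-≤ i∈ j∈ (<⇒≤ i<j) ⟩
    j              ≤⟨ ≮⇒≥ (λ l<j → contradiction (trans (sym Sl) (gap l i<l l<j)) λ ()) ⟩
    l              ≡⟨ dist-≤ i∈ (S⊆[N] Sl) (<⇒≤ i<l) ⟨
    i + dist i l   ∎)
    where open ≤-Reasoning
  ... | tri> _ _ l<i = +-cancelˡ-≤ i _ _ (begin
    i + dist i j   ≡⟨ dist-≤ i∈ j∈ (<⇒≤ i<j) ⟩
    j              ≤⟨ j≤N ⟩
    N              ≤⟨ m≤m+n N l ⟩
    N + l          ≡⟨ dist-> i∈ (S⊆[N] Sl) l<i ⟨
    i + dist i l   ∎)
    where open ≤-Reasoning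

  extremes⇒successor : ∀ {S i j} → (∀ {l} → S l ≡ true → l ∈[N]) → i ∈[N] → j ∈[N]
    → (∀ m → S m ≡ true → j ≤ m × m ≤ i) → Successor S i j
  extremes⇒successor {S} {i} {j} S⊆[N] i∈ j∈ bounds {l} Sl l≢i = +-cancelˡ-≤ i _ _ (begin
    i + dist i j   ≡⟨ dist-> i∈ j∈ (≤-<-trans j≤l l<i) ⟩
    N + j          ≤⟨ +-monoʳ-≤ N j≤l ⟩
    N + l          ≡⟨ dist-> i∈ (S⊆[N] Sl) l<i ⟨
    i + dist i l   ∎)
    where
    open ≤-Reasoning
    j≤l = proj₁ (bounds l Sl)
    l<i = ≤∧≢⇒< (proj₂ (bounds l Sl)) l≢i

modN≡% : ∀ q d .{{_ : NonZero d}} → modN q d ≡ q % d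
modN≡% q (suc d) = refl

module Exploration {n : ℕ} (tour : ℕ → Fin n) (G : ℕ → Graph n) .{{_ : NonZero (tourLength n)}} where

  open Process tour G
  open Circle N public

  moves : ℕ → ℕ → ℕ
  moves i zero    = 0
  moves i (suc t) = if edgePresent (suc t) (state i t) then suc (moves i t) else moves i t

  moves≤t : ∀ i t → moves i t ≤ t
  moves≤t i zero = z≤n
  moves≤t i (suc t) with edgePresent (suc t) (state i t)
  ... | true  = s≤s (moves≤t i t)
  ... | false = m≤n⇒m≤1+n (moves≤t i t)

  moves-mono : ∀ i t → moves i t ≤ moves i (suc t)
  moves-mono i t with edgePresent (suc t) (state i t)
  ... | true  = n≤1+n (moves i t)
  ... | false = ≤-refl

  moves-suc≤ : ∀ i t → moves i (suc t) ≤ suc (moves i t)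
  moves-suc≤ i t with edgePresent (suc t) (state i t)
  ... | true  = ≤-refl
  ... | false = n≤1+n (moves i t)

  state-∈[N] : ∀ {i} t → i ∈[N] → state i t ∈[N]
  state-∈[N] zero i∈ = i∈
  state-∈[N] {i} (suc t) i∈ with edgePresent (suc t) (state i t)
  ... | true  = s≤s z≤n , subst (λ q → suc q ≤ N) (sym (modN≡% (state i t) N)) (m%n<n (state i t) N)
  ... | false = state-∈[N] t i∈

  state-≋ : ∀ i t → i + moves i t ≋ state i t
  state-≋ i zero = cong (_% N) (+-identityʳ i)
  state-≋ i (suc t) with edgePresent (suc t) (state i t)
  ... | false = state-≋ i t
  ... | true  = begin
    (i + suc (moves i t)) % N     ≡⟨ cong (_% N) (+-suc i (moves i t)) ⟩
    suc (i + moves i t) % N       ≡⟨ ≋-+ {1} refl (state-≋ i t) ⟩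
    suc (state i t) % N           ≡⟨ ≋-+ {1} refl (%-≋ (state i t)) ⟨
    suc (state i t % N) % N       ≡⟨ cong (λ q → suc q % N) (modN≡% (state i t) N) ⟨
    suc (modN (state i t) N) % N  ∎
    where open ≡-Reasoning

  dist-state : ∀ {i} t → i ≤ N → dist i (state i t) ≡ moves i t % N
  dist-state {i} t i≤N = sym (dist-unique i≤N (m%n<n (moves i t) N)
    (trans (≋-+ {i} refl (%-≋ (moves i t))) (state-≋ i t)))

  Reached : ℕ → ℕ → ℕ → Set
  Reached i t x = dist i x ≤ moves i t

  D⇒reached : ∀ {i x} t → i ∈[N] → D i t x → x ∈[N] × Reached i t x
  D⇒reached {i} t i∈ x∈D with CInt⇒dist≤ i∈ (state-∈[N] t i∈) x∈D
  ... | x∈ , ix≤is =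
    x∈ , ≤-trans ix≤is (≤-trans (≤-reflexive (dist-state t (proj₂ i∈))) (m%n≤m (moves i t) N))

  reached⇒D : ∀ {i x} t → i ∈[N] → x ∈[N] → Reached i t x → moves i t < N → D i t x
  reached⇒D {i} t i∈ x∈ reached moves<N = dist≤⇒CInt i∈ (state-∈[N] t i∈) x∈
    (≤-trans reached (≤-reflexive (trans (sym (m<n⇒m%n≡m moves<N)) (sym (dist-state t (proj₂ i∈))))))

  level⇒same-state : ∀ {i l} t → i ∈[N] → l ∈[N] → dist i l + moves l t ≡ N + moves i t
    → state i t ≡ state l t
  level⇒same-state {i} {l} t i∈ l∈ e = ∈[N]-≋⇒≡ (state-∈[N] t i∈) (state-∈[N] t l∈) (begin
    state i t % N                   ≡⟨ state-≋ i t ⟨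
    (i + moves i t) % N             ≡⟨ N+-≋ (i + moves i t) ⟨
    (N + (i + moves i t)) % N       ≡⟨ cong (_% N) (x∙yz≈y∙xz N i (moves i t)) ⟩
    (i + (N + moves i t)) % N       ≡⟨ cong (λ q → (i + q) % N) e ⟨
    (i + (dist i l + moves l t)) % N  ≡⟨ cong (_% N) (+-assoc i (dist i l) (moves l t)) ⟨
    (i + dist i l + moves l t) % N  ≡⟨ ≋-+ (dist-spec l (proj₂ i∈)) refl ⟩
    (l + moves l t) % N             ≡⟨ state-≋ l t ⟩
    state l t % N                   ∎)
    where open ≡-Reasoning

  lockstep : ∀ {i l} t d → state i t ≡ state l t → d + moves l t ≡ N + moves i t
    → d + moves l (suc t) ≡ N + moves i (suc t)
  lockstep {i} {l} t d same e rewrite same with edgePresent (suc t) (state l t)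
  ... | true  = trans (+-suc d (moves l t)) (trans (cong suc e) (sym (+-suc N (moves i t))))
  ... | false = e

  no-overtaking : ∀ {i l} t → i ∈[N] → l ∈[N] → dist i l + moves l t ≤ N + moves i t
  no-overtaking {i} {l} zero i∈ l∈ = ≤-trans (≤-reflexive (+-identityʳ (dist i l)))
    (≤-trans (<⇒≤ (dist<N i l)) (m≤m+n N 0))
  no-overtaking {i} {l} (suc t) i∈ l∈ with m≤n⇒m<n∨m≡n (no-overtaking t i∈ l∈)
  ... | inj₁ behind = begin
    dist i l + moves l (suc t)   ≤⟨ +-monoʳ-≤ (dist i l) (moves-suc≤ l t) ⟩
    dist i l + suc (moves l t)   ≡⟨ +-suc (dist i l) (moves l t) ⟩
    suc (dist i l + moves l t)   ≤⟨ behind ⟩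
    N + moves i t                ≤⟨ +-monoʳ-≤ N (moves-mono i t) ⟩
    N + moves i (suc t)          ∎
    where open ≤-Reasoning
  ... | inj₂ level = ≤-reflexive (lockstep t (dist i l) (level⇒same-state t i∈ l∈ level) level)

  lapped⇒reached : ∀ {i l x} t → i ∈[N] → l ∈[N] → D l t x → dist i x < dist i l → Reached i t x
  lapped⇒reached {i} {l} {x} t i∈ l∈ x∈Dl ix<il with D⇒reached t l∈ x∈Dl
  ... | _ , lx≤ml = +-cancelˡ-≤ N _ _ (begin
    N + dist i x                 ≡⟨ dist-+-wrap (proj₂ i∈) (proj₂ l∈) ix<il ⟨
    dist i l + dist l x          ≤⟨ +-monoʳ-≤ (dist i l) lx≤ml ⟩
    dist i l + moves l t         ≤⟨ no-overtaking t i∈ l∈ ⟩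
    N + moves i t                ∎)
    where open ≤-Reasoning

  _⊆_ : AgentSet → AgentSet → Set
  S ⊆ U = ∀ {x} → S x ≡ true → U x ≡ true

  remove⁻ : ∀ S {m x} → remove S m x ≡ true → S x ≡ true × x ≢ m
  remove⁻ S {m} {x} e with S x | x ≡ᵇ m in x≡ᵇm
  ... | true  | false = refl , λ x≡m → subst T x≡ᵇm (≡⇒≡ᵇ x m x≡m)
  remove⁻ S {m} {x} () | true  | true
  remove⁻ S {m} {x} () | false | _

  remove⁺ : ∀ S {m x} → S x ≡ true → x ≢ m → remove S m x ≡ true
  remove⁺ S {m} {x} Sx x≢m with S x | x ≡ᵇ m in x≡ᵇm
  ... | true  | false = refl
  ... | true  | true  = contradiction (≡ᵇ⇒≡ x m (subst T (sym x≡ᵇm) tt)) x≢m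
  remove⁺ S {m} {x} () x≢m | false | _

  remove-⊆ : ∀ S {m} → remove S m ⊆ S
  remove-⊆ S e = proj₁ (remove⁻ S e)

  removeAll-⊆ : ∀ S is → removeAll S is ⊆ S
  removeAll-⊆ S []       e = e
  removeAll-⊆ S (m ∷ is) e = remove-⊆ S (removeAll-⊆ (remove S m) is e)

  initial⇒∈[N] : ∀ {x} → initial x ≡ true → x ∈[N]
  initial⇒∈[N] {x} e with Equivalence.to T-∧ (Equivalence.from T-≡ e)
  ... | 1≤ᵇx , x≤ᵇN = ≤ᵇ⇒≤ 1 x 1≤ᵇx , ≤ᵇ⇒≤ x N x≤ᵇN

  ∈[N]⇒initial : ∀ {x} → x ∈[N] → initial x ≡ true
  ∈[N]⇒initial (1≤x , x≤N) = Equivalence.to T-≡ (Equivalence.from T-∧ (≤⇒≤ᵇ 1≤x , ≤⇒≤ᵇ x≤N))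

  Unlapped : ℕ → AgentSet → Set
  Unlapped t S = ∀ {a b} → S a ≡ true → S b ≡ true → a ≢ b → moves a t < N

  unlapped-⊆ : ∀ {t S U} → S ⊆ U → Unlapped t U → Unlapped t S
  unlapped-⊆ S⊆U unlapped Sa Sb = unlapped (S⊆U Sa) (S⊆U Sb)

  Covers : ℕ → AgentSet → Set
  Covers t S = ∀ {i j x} → S i ≡ true → S j ≡ true → Successor S i j
    → x ∈[N] → dist i x < dist i j → Reached i t x

  covers-suc : ∀ {t S} → Covers t S → Covers (suc t) S
  covers-suc {t} covers {i} Si Sj succ x∈ x<j = ≤-trans (covers Si Sj succ x∈ x<j) (moves-mono i t)

  covers-initial : Covers 0 initial
  covers-initial {i} {j} {x} Si Sj succ x∈ x<j with x ≟ i
  ... | yes refl = ≤-reflexive (dist-self (proj₂ x∈))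
  ... | no x≢i   = contradiction (succ (∈[N]⇒initial x∈) x≢i) (<⇒≱ x<j)

  covered⇒reached : ∀ {S i j l x} t → S ⊆ initial → S i ≡ true → Successor S i j
    → S l ≡ true → D l t x → dist i x < dist i j → Reached i t x
  covered⇒reached {S} {i} {j} {l} t S⊆ Si succ Sl x∈Dl x<j with l ≟ i
  ... | yes refl = proj₂ (D⇒reached t (initial⇒∈[N] {i} (S⊆ Si)) x∈Dl)
  ... | no l≢i   = lapped⇒reached t (initial⇒∈[N] {i} (S⊆ Si)) (initial⇒∈[N] {l} (S⊆ Sl)) x∈Dl
                     (<-≤-trans x<j (succ Sl l≢i))

  successor-remove : ∀ {S m i j k} → dist i k ≤ dist i j → dist i k ≤ dist i m
    → Successor (remove S m) i j → Successor S i k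
  successor-remove {S} {m} k≤j k≤m succ {l} Sl l≢i with l ≟ m
  ... | yes refl = k≤m
  ... | no l≢m   = ≤-trans k≤j (succ (remove⁺ S Sl l≢m) l≢i)

  successor-removed : ∀ {S m i j} → i ∈[N] → m ∈[N] → i ≢ m → dist i m < dist i j
    → Successor (remove S m) i j → Successor S m j
  successor-removed {S} {m} {i} {j} i∈ m∈ i≢m m<j succ {l} Sl l≢m with l ≟ i
  ... | yes refl = <⇒≤ (+-cancelˡ-< (dist i m) _ _ (begin-strict
    dist i m + dist m j   ≡⟨ dist-+ (proj₂ i∈) (proj₂ m∈) (<⇒≤ m<j) ⟩
    dist i j              <⟨ dist<N i j ⟩
    N                     ≡⟨ dist-cycle i∈ m∈ i≢m ⟨
    dist i m + dist m i   ∎))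
    where open ≤-Reasoning
  ... | no l≢i   = +-cancelˡ-≤ (dist i m) _ _ (begin
    dist i m + dist m j   ≡⟨ dist-+ (proj₂ i∈) (proj₂ m∈) (<⇒≤ m<j) ⟩
    dist i j              ≤⟨ j≤l ⟩
    dist i l              ≡⟨ dist-+ (proj₂ i∈) (proj₂ m∈) (≤-trans (<⇒≤ m<j) j≤l) ⟨
    dist i m + dist m l   ∎)
    where
    open ≤-Reasoning
    j≤l = succ (remove⁺ S Sl l≢m) l≢i

  module _ {t S m} (S⊆ : S ⊆ initial) (unlapped : Unlapped t S) (Sm : S m ≡ true)
           (redundant : Redundant t S m) (covers : Covers t S) where

    reached-beyond-removed : ∀ {i j x} → S i ≡ true → i ≢ m → S j ≡ true → Successor (remove S m) i j
      → dist i m < dist i j → x ∈[N] → dist i m ≤ dist i x → dist i x < dist i j → Reached i t x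
    reached-beyond-removed {i} {j} {x} Si i≢m Sj succ m<j x∈ m≤x x<j =
      let l , Sl , l≢m , x∈Dl = redundant x x∈Dm
      in covered⇒reached t (λ e → S⊆ (remove-⊆ S e)) (remove⁺ S Si i≢m) succ
           (remove⁺ S Sl l≢m) x∈Dl x<j
      where
      i∈ = initial⇒∈[N] {i} (S⊆ Si)
      m∈ = initial⇒∈[N] {m} (S⊆ Sm)
      mx<mj : dist m x < dist m j
      mx<mj = +-cancelˡ-< (dist i m) _ _ (begin-strict
        dist i m + dist m x   ≡⟨ dist-+ (proj₂ i∈) (proj₂ m∈) m≤x ⟩
        dist i x              <⟨ x<j ⟩
        dist i j              ≡⟨ dist-+ (proj₂ i∈) (proj₂ m∈) (<⇒≤ m<j) ⟨
        dist i m + dist m j   ∎)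
        where open ≤-Reasoning
      x∈Dm : D m t x
      x∈Dm = reached⇒D t m∈ x∈ (covers Sm Sj (successor-removed i∈ m∈ i≢m m<j succ) x∈ mx<mj)
               (unlapped Sm Si (λ m≡i → i≢m (sym m≡i)))

    covers-remove : Covers t (remove S m)
    covers-remove {i} {j} {x} S′i S′j succ x∈ x<j with remove⁻ S S′i | remove⁻ S S′j
    ... | Si , i≢m | Sj , _ with dist i j ≤? dist i m
    ...   | yes j≤m = covers Si Sj (successor-remove ≤-refl j≤m succ) x∈ x<j
    ...   | no j≰m with dist i x <? dist i m
    ...     | yes x<m = covers Si Sm (successor-remove (<⇒≤ (≰⇒> j≰m)) ≤-refl succ) x∈ x<m
    ...     | no x≮m  = reached-beyond-removed Si i≢m Sj succ (≰⇒> j≰m) x∈ (≮⇒≥ x≮m) x<j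

  covers-removeAll : ∀ {t S} is → S ⊆ initial → Unlapped t S → ValidElim t S is
    → Covers t S → Covers t (removeAll S is)
  covers-removeAll []       _  _        _                          covers = covers
  covers-removeAll {t} {S} (m ∷ is) S⊆ unlapped (Sm , redundant , valid) covers =
    covers-removeAll is (λ e → S⊆ (remove-⊆ S e)) (unlapped-⊆ {t} (remove-⊆ S) unlapped) valid
      (covers-remove {t} S⊆ unlapped Sm redundant covers)

  successor-gap⊆D : ∀ {t S i j x} → S ⊆ initial → Unlapped t S → Covers t S
    → S i ≡ true → S j ≡ true → Successor S i j → CIntHO N i j x → D i t x
  successor-gap⊆D {t} {S} {i} {j} {x} S⊆ unlapped covers Si Sj succ (x∈[i,j] , x≢j) =
    reached⇒D t i∈ x∈ (covers Si Sj succ x∈ x<j) (unlapped Si Sj i≢j)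
    where
    i∈ = initial⇒∈[N] {i} (S⊆ Si)
    j∈ = initial⇒∈[N] {j} (S⊆ Sj)
    x∈ = proj₁ (CInt⇒dist≤ i∈ j∈ x∈[i,j])
    x<j : dist i x < dist i j
    x<j = ≤∧≢⇒< (proj₂ (CInt⇒dist≤ i∈ j∈ x∈[i,j]))
                (λ e → x≢j (dist-injective (proj₂ i∈) x∈ j∈ e))
    i≢j : i ≢ j
    i≢j refl = n≮0 (subst (dist i x <_) (dist-self (proj₂ i∈)) x<j)

  module Run (2≤N : 2 ≤ N) {rem : ℕ → List ℕ} (run : IsRun rem) where

    alive-⊆ : ∀ t → alive rem (suc t) ⊆ alive rem t
    alive-⊆ t = removeAll-⊆ (alive rem t) (rem (suc t))

    alive-⊆-initial : ∀ t → alive rem t ⊆ initial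
    alive-⊆-initial zero    e = e
    alive-⊆-initial (suc t) e = alive-⊆-initial t (alive-⊆ t e)

    alive⇒∈[N] : ∀ t {x} → alive rem t x ≡ true → x ∈[N]
    alive⇒∈[N] t {x} e = initial⇒∈[N] {x} (alive-⊆-initial t e)

    alive-unlapped : ∀ {t} → suc t ≤ N → Unlapped (suc t) (alive rem t)
    alive-unlapped {zero}  _   {a} _  _  _   = <-≤-trans (s≤s (moves≤t a 1)) 2≤N
    alive-unlapped {suc t} t<N {a} {b} Aa Ab a≢b with moves a (suc (suc t)) <? N
    ... | yes unlapped = unlapped
    ... | no lapped    = contradiction b-redundant (proj₂ (run (suc t) (s≤s z≤n) (<⇒≤ t<N)) b Ab)
      where
      b-redundant : Redundant (suc t) (alive rem (suc t)) b
      b-redundant x x∈Db = a , Aa , a≢b ,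
        reached⇒D (suc t) (alive⇒∈[N] (suc t) Aa)
          (proj₁ (D⇒reached (suc t) (alive⇒∈[N] (suc t) Ab) x∈Db))
          (≤-pred (≤-trans (dist<N a x) (≤-trans (≮⇒≥ lapped) (moves-suc≤ a (suc t)))))
          (≤-<-trans (moves≤t a (suc t)) t<N)

    covers-alive : ∀ t → t ≤ N → Covers t (alive rem t)
    covers-alive zero    _   = covers-initial
    covers-alive (suc t) t<N =
      covers-removeAll (rem (suc t)) (alive-⊆-initial t) (alive-unlapped t<N)
        (proj₁ (run (suc t) (s≤s z≤n) t<N)) (covers-suc (covers-alive t (<⇒≤ t<N)))

    alive-successor-gap⊆D : ∀ {t i j x} → suc t ≤ N
      → alive rem (suc t) i ≡ true → alive rem (suc t) j ≡ true → Successor (alive rem (suc t)) i j → CIntHO N i j x → D i (suc t) x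
    alive-successor-gap⊆D {t} t<N = successor-gap⊆D (alive-⊆-initial (suc t))
      (unlapped-⊆ {suc t} (alive-⊆ t) (alive-unlapped t<N)) (covers-alive (suc t) t<N)

lemma10 : (n k : ℕ) → 2 ≤ n → 1 ≤ k
    → (T : Graph n) → IsTree T → (r : Fin n)
    → (tour : ℕ → Fin n) → IsDFSTour T r tour
    → (G : ℕ → Graph n)
    → (∀ t → 1 ≤ t → t ≤ tourLength n → missingEdges T (G t) ≤ k)
    → (rem : ℕ → List ℕ) → Process.IsRun tour G rem
    → ∀ t → 1 ≤ t → t ≤ tourLength n →
      -- (i) consecutive agents i < j of A(t): [i, j) ⊆ D_i(t)
      (∀ i j → Process.alive tour G rem t i ≡ true → Process.alive tour G rem t j ≡ true
        → i < j → (∀ m → i < m → m < j → Process.alive tour G rem t m ≡ false)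
        → ∀ x → CIntHO (tourLength n) i j x → Process.D tour G i t x)
      ×
      -- (ii) i = max index, j = min index of A(t): [i, j) ⊆ D_i(t)
      (∀ i j → Process.alive tour G rem t i ≡ true → Process.alive tour G rem t j ≡ true
        → (∀ m → Process.alive tour G rem t m ≡ true → j ≤ m × m ≤ i)
        → ∀ x → CIntHO (tourLength n) i j x → Process.D tour G i t x)
lemma10 n _ 2≤n _ _ _ _ tour _ G _ rem run (suc t) (s≤s z≤n) t<N =
    (λ i j Ai Aj i<j gap _ → alive-successor-gap⊆D t<N Ai Aj
       (consecutive⇒successor (alive⇒∈[N] (suc t)) (alive⇒∈[N] (suc t) Ai) (alive⇒∈[N] (suc t) Aj)
          i<j gap))
  , (λ i j Ai Aj bounds _ → alive-successor-gap⊆D t<N Ai Aj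
       (extremes⇒successor (alive⇒∈[N] (suc t)) (alive⇒∈[N] (suc t) Ai) (alive⇒∈[N] (suc t) Aj)
          bounds))
  where
  2≤N : 2 ≤ tourLength n
  2≤N = *-monoʳ-≤ 2 (∸-monoˡ-≤ 1 2≤n)
  instance
    N≢0 : NonZero (tourLength n)
    N≢0 = >-nonZero (<-≤-trans (s≤s z≤n) 2≤N)
  open Exploration tour G
  open Run 2≤N run
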